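{- Let $q$ be a prime power, $1<k<n-1$ with $2k>n$, and $V=\mathbb{F}_q^n$. For every $(k+1)$-dimensional subspace $U$ of $V$ not contained in any coordinate hyperplane, the set $\langle U]^c_k$ of all $k$-dimensional subspaces of $U$ not contained in any coordinate hyperplane is a maximal clique of the graph $\Gamma(n,k)_q$.
   Context: Coordinate hyperplanes: $C_i=\{x\in V: x_i=0\}$. $\mathcal{C}(n,k)_q$ is the set of $k$-dimensional subspaces of $V$ not contained in any $C_i$, and $\Gamma(n,k)_q$ is the graph on $\mathcal{C}(n,k)_q$ where two vertices are adjacent iff their intersection is $(k-1)$-dimensional. -}

module Defs where

open import Level using (0ℓ)
open import Data.Nat using (ℕ; zero; suc; _^_; _∸_)
open import Data.Nat.Primality using (Prime)
open import Data.Fin using (Fin; zero; suc)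
open import Data.Product using (Σ; ∃; _×_; _,_)
open import Relation.Nullary using (¬_)
open import Relation.Binary.PropositionalEquality as ≡ using (_≡_)
open import Function.Bundles using (Bijection)
open import Algebra.Bundles using (CommutativeRing)

IsPrimePower : ℕ → Set
IsPrimePower q = Σ ℕ λ p → Σ ℕ λ e → Prime p × q ≡ p ^ suc e

record IsField (R : CommutativeRing 0ℓ 0ℓ) : Set where
  open CommutativeRing R
  field
    1≉0     : ¬ (1# ≈ 0#)
    inverse : ∀ x → ¬ (x ≈ 0#) → Σ Carrier λ y → x * y ≈ 1#

record FiniteField (q : ℕ) : Set₁ where
  field
    cring   : CommutativeRing 0ℓ 0ℓ
    isField : IsField cring
    card    : Bijection (CommutativeRing.setoid cring) (≡.setoid (Fin q))
  open CommutativeRing cring public hiding (ring)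

module LinearAlgebra {q : ℕ} (F : FiniteField q) where
  open FiniteField F using (Carrier; _≈_; _+_; _*_; 0#; 1#)

  V : ℕ → Set
  V n = Fin n → Carrier

  _≈v_ : ∀ {n} → V n → V n → Set
  x ≈v y = ∀ i → x i ≈ y i

  0v : ∀ {n} → V n
  0v i = 0#

  sumF : ∀ {m} → (Fin m → Carrier) → Carrier
  sumF {zero}  c = 0#
  sumF {suc m} c = c zero + sumF (λ j → c (suc j))

  lincomb : ∀ {m n} → (Fin m → Carrier) → (Fin m → V n) → V n
  lincomb c b i = sumF (λ j → c j * b j i)

  LinIndep : ∀ {m n} → (Fin m → V n) → Set
  LinIndep b = ∀ c → lincomb c b ≈v 0v → ∀ j → c j ≈ 0#

  Span : ∀ {m n} → (Fin m → V n) → V n → Set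
  Span b x = Σ _ λ c → x ≈v lincomb c b

  -- sets of vectors (subspaces are represented by their membership predicate)
  VSet : ℕ → Set₁
  VSet n = V n → Set

  _∩_ : ∀ {n} → VSet n → VSet n → VSet n
  (W ∩ X) x = W x × X x

  _⊆_ : ∀ {n} → VSet n → VSet n → Set
  W ⊆ X = ∀ x → W x → X x

  _≐_ : ∀ {n} → VSet n → VSet n → Set
  W ≐ X = W ⊆ X × X ⊆ W

  HasDim : ∀ {n} → VSet n → ℕ → Set
  HasDim {n} W d = Σ (Fin d → V n) λ b → LinIndep b × (W ≐ Span b)

  C : ∀ {n} → Fin n → VSet n
  C i x = x i ≈ 0#

  NotInCoordHyperplane : ∀ {n} → VSet n → Set
  NotInCoordHyperplane W = ∀ i → ¬ (W ⊆ C i)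

  Vertex : (n k : ℕ) → VSet n → Set
  Vertex n k W = HasDim W k × NotInCoordHyperplane W

  Adjacent : (n k : ℕ) → VSet n → VSet n → Set
  Adjacent n k W X = HasDim (W ∩ X) (k ∸ 1)

  IsClique : (n k : ℕ) → (VSet n → Set) → Set₁
  IsClique n k K =
    (∀ W → K W → Vertex n k W) ×
    (∀ W X → K W → K X → ¬ (W ≐ X) → Adjacent n k W X)

  IsMaximalClique : (n k : ℕ) → (VSet n → Set) → Set₁
  IsMaximalClique n k K =
    IsClique n k K ×
    (∀ W → Vertex n k W → (∀ X → K X → ¬ (X ≐ W) → Adjacent n k W X) → K W)

  SubsC : (n k : ℕ) → VSet n → VSet n → Set
  SubsC n k U W = W ⊆ U × Vertex n k W

module Submission where

-- In coordinates with respect to a basis B of U, the k-dimensional subspaces of U are the kernels of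
-- nonzero functionals β on F^(k+1). Two distinct ones, W and X, meet in dimension k - 1: a vector of W
-- outside X completes a basis of X to one of U, and W ∩ X is cut out in W by the coefficient of that vector.
-- For maximality let W ⊄ U be adjacent to every member of ⟨U]^c_k. Each such member X meets W in a
-- (k - 1)-dimensional subspace of U, and a vector of W outside U completes it to a basis of W, so W ∩ X = W ∩ U.
-- As k ≥ 2 there is some y ≠ 0 in W ∩ U, and it remains to find X ∈ ⟨U]^c_k with y ∉ X. Consider the 2^k
-- functionals β with a ∙ β = 1 (a the coordinates of y) and 0/1 entries off a pivot of a: for each i, the
-- kernel of at most one of them lies in C_i, and n < 2k ≤ 2^k.

open import Defs
open import Data.Nat using (ℕ; zero; suc; _≤_; _<_; _^_; z≤n; s≤s)
open import Data.Nat.Properties using (m≤n⇒m≤1+n; n≮n)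
open import Data.Fin using (Fin; zero; suc; punchIn; fromℕ<; combine; finToFun; funToFin)
import Data.Fin.Properties as Fin
open import Data.Vec.Functional using (_∷_; tail; insertAt; removeAt)
open import Data.Vec.Functional.Properties using (insertAt-lookup; insertAt-punchIn; removeAt-insertAt)
open import Data.Product using (∃; _×_; _,_; proj₁; proj₂)
open import Data.Sum using (_⊎_; inj₁; inj₂)
open import Data.Empty using (⊥-elim)
open import Function using (_∘_)
open import Function.Bundles using (Bijection)
open import Relation.Nullary using (¬_; Dec; yes; no)
open import Relation.Binary.Definitions using (Decidable)
open import Relation.Binary.PropositionalEquality as ≡ using (_≡_; _≗_)
open import Algebra.Bundles using (CommutativeRing)

funToFin-cong : ∀ {m n} {f g : Fin m → Fin n} → f ≗ g → funToFin f ≡ funToFin g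
funToFin-cong {zero} _ = ≡.refl
funToFin-cong {suc m} f≗g = ≡.cong₂ combine (f≗g zero) (funToFin-cong (f≗g ∘ suc))

finToFun-injective : ∀ {m n} (x y : Fin (m ^ n)) → finToFun {m} {n} x ≗ finToFun y → x ≡ y
finToFun-injective {m} {n} x y x≗y = ≡.trans (≡.sym (Fin.funToFin-finToFin {n} {m} x))
  (≡.trans (funToFin-cong x≗y) (Fin.funToFin-finToFin {n} {m} y))

∀⊎∃¬ : ∀ {m} (P : Fin m → Set) → (∀ j → Dec (P j)) → (∀ j → P j) ⊎ ∃ λ j → ¬ P j
∀⊎∃¬ {m} P P? with Fin.all? P?
... | yes ∀P = inj₁ ∀P
... | no ¬∀P = inj₂ (Fin.¬∀⟶∃¬ m P P? ¬∀P)

module _ {q : ℕ} (F : FiniteField q) where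
  open FiniteField F hiding (zero)
  open LinearAlgebra F
  open import Algebra.Properties.CommutativeMonoid.Sum +-commutativeMonoid
    using (sum; sum-remove; ∑-distrib-+; ∑-comm; sum-cong-≋; sum-replicate-zero)
  open import Algebra.Properties.Semiring.Sum semiring using (*-distribˡ-sum; *-distribʳ-sum)
  open import Algebra.Properties.Ring (CommutativeRing.ring cring) using (-1*x≈-x; -‿distribˡ-*)
  open import Algebra.Properties.Group +-group using (x∙y⁻¹≈ε⇒x≈y; inverseʳ-unique; ⁻¹-involutive)
  open import Algebra.Solver.Ring.NaturalCoefficients.Default commutativeSemiring
  open import Relation.Binary.Reasoning.Setoid setoid

  infix 4 _≈?_ _≈v?_
  _≈?_ : Decidable _≈_
  x ≈? y with Bijection.to card x Fin.≟ Bijection.to card y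
  ... | yes eq = yes (Bijection.injective card eq)
  ... | no neq = no (neq ∘ Bijection.cong card)

  1≉0 : 1# ≉ 0#
  1≉0 = IsField.1≉0 isField

  inv : ∀ x → x ≉ 0# → Carrier
  inv x x≉0 = proj₁ (IsField.inverse isField x x≉0)

  *-inverseʳ : ∀ x (x≉0 : x ≉ 0#) → x * inv x x≉0 ≈ 1#
  *-inverseʳ x x≉0 = proj₂ (IsField.inverse isField x x≉0)

  *-inverseˡ : ∀ x (x≉0 : x ≉ 0#) → inv x x≉0 * x ≈ 1#
  *-inverseˡ x x≉0 = trans (*-comm _ x) (*-inverseʳ x x≉0)

  inv-cancelˡ : ∀ s (s≉0 : s ≉ 0#) x → inv s s≉0 * (s * x) ≈ x
  inv-cancelˡ s s≉0 x = begin
    inv s s≉0 * (s * x)  ≈⟨ *-assoc _ s x ⟨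
    inv s s≉0 * s * x    ≈⟨ *-cong (*-inverseˡ s s≉0) refl ⟩
    1# * x               ≈⟨ *-identityˡ x ⟩
    x                    ∎

  x-y≈0⇒x≈y : ∀ {x y} → x + (- 1#) * y ≈ 0# → x ≈ y
  x-y≈0⇒x≈y {x} {y} x-y≈0 = x∙y⁻¹≈ε⇒x≈y x y (trans (+-cong refl (sym (-1*x≈-x y))) x-y≈0)

  x+y-y≈x : ∀ x y → x + y + (- 1#) * y ≈ x
  x+y-y≈x x y = begin
    x + y + (- 1#) * y   ≈⟨ +-assoc x y _ ⟩
    x + (y + (- 1#) * y) ≈⟨ +-cong refl (trans (+-cong refl (-1*x≈-x y)) (-‿inverseʳ y)) ⟩
    x + 0#               ≈⟨ +-identityʳ x ⟩
    x                    ∎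

  -- Finiteness of F is used only here: equality and span membership become decidable by exhaustive
  -- search, which provides the case distinctions of the argument.
  private
    module Card = Bijection card

    enumerate : Fin q → Carrier
    enumerate i = proj₁ (Card.surjective i)

    enumerate-to : ∀ x → enumerate (Card.to x) ≈ x
    enumerate-to x = Card.injective (proj₂ (Card.surjective (Card.to x)) refl)

  ∃-carrier? : (P : Carrier → Set) → (∀ {x y} → x ≈ y → P x → P y) →
               (∀ x → Dec (P x)) → Dec (∃ P)
  ∃-carrier? P resp P? with Fin.any? (P? ∘ enumerate)
  ... | yes (i , p) = yes (_ , p)
  ... | no ¬p = no λ (x , px) → ¬p (Card.to x , resp (sym (enumerate-to x)) px)

  ∃-vector? : ∀ {m} (P : V m → Set) → (∀ {x y} → x ≈v y → P x → P y) →
              (∀ x → Dec (P x)) → Dec (∃ P)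
  ∃-vector? {zero} P resp P? with P? (λ ())
  ... | yes p = yes (_ , p)
  ... | no ¬p = no λ (x , px) → ¬p (resp (λ ()) px)
  ∃-vector? {suc m} P resp P?
    with ∃-carrier? (λ a → ∃ λ x → P (a ∷ x))
           (λ a≈b (x , p) → x , resp (λ { zero → a≈b ; (suc i) → refl }) p)
           (λ a → ∃-vector? (P ∘ (a ∷_)) (λ x≈y → resp λ { zero → refl ; (suc i) → x≈y i }) (P? ∘ (a ∷_)))
  ... | yes (a , x , p) = yes (a ∷ x , p)
  ... | no ¬p = no λ (x , px) → ¬p (x zero , x ∘ suc , resp (λ { zero → refl ; (suc i) → refl }) px)

  sumF≡sum : ∀ {m} (f : V m) → sumF f ≡ sum f
  sumF≡sum {zero} f = ≡.refl
  sumF≡sum {suc m} f = ≡.cong (f zero +_) (sumF≡sum (f ∘ suc))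

  -- _≈v_ has the default precedence 20.
  infixl 26 _+ᵛ_ _-ᵛ_
  infixr 27 _·ᵛ_
  infix 8 _ᵀ _∙_

  _+ᵛ_ : ∀ {n} → V n → V n → V n
  (x +ᵛ y) i = x i + y i

  _·ᵛ_ : ∀ {n} → Carrier → V n → V n
  (s ·ᵛ x) i = s * x i

  _-ᵛ_ : ∀ {n} → V n → V n → V n
  x -ᵛ y = x +ᵛ (- 1#) ·ᵛ y

  _≈v?_ : ∀ {n} → Decidable (_≈v_ {n})
  x ≈v? y = Fin.all? λ i → x i ≈? y i

  unit : ∀ {n} → Fin n → V n
  unit {suc n} p = insertAt 0v p 1#

  _∙_ : ∀ {m} → V m → V m → Carrier
  c ∙ β = sumF λ j → c j * β j

  -- lincomb c b i is definitionally c ∙ (b ᵀ) i.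
  _ᵀ : ∀ {m n} → (Fin m → V n) → Fin n → V m
  (b ᵀ) i j = b j i

  module _ {m : ℕ} where
    sumF-cong : ∀ {f g : V m} → f ≈v g → sumF f ≈ sumF g
    sumF-cong {f} {g} f≈g rewrite sumF≡sum f | sumF≡sum g = sum-cong-≋ f≈g

    sumF-0 : sumF {m} 0v ≈ 0#
    sumF-0 rewrite sumF≡sum {m} 0v = sum-replicate-zero m

    sumF-+ : ∀ (f g : V m) → sumF (f +ᵛ g) ≈ sumF f + sumF g
    sumF-+ f g rewrite sumF≡sum (f +ᵛ g) | sumF≡sum f | sumF≡sum g = ∑-distrib-+ f g

    sumF-*ˡ : ∀ s (f : V m) → sumF (s ·ᵛ f) ≈ s * sumF f
    sumF-*ˡ s f rewrite sumF≡sum (s ·ᵛ f) | sumF≡sum f = sym (*-distribˡ-sum s f)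

    sumF-*ʳ : ∀ s (f : V m) → sumF (λ j → f j * s) ≈ sumF f * s
    sumF-*ʳ s f rewrite sumF≡sum (λ j → f j * s) | sumF≡sum f = sym (*-distribʳ-sum s f)

  sumF-remove : ∀ {m} (f : V (suc m)) p → sumF f ≈ f p + sumF (removeAt f p)
  sumF-remove f p rewrite sumF≡sum f | sumF≡sum (removeAt f p) = sum-remove f

  sumF-comm : ∀ {m l} (f : Fin m → Fin l → Carrier) →
              sumF (λ i → sumF (f i)) ≈ sumF (λ j → sumF λ i → f i j)
  sumF-comm f = begin
    sumF (λ i → sumF (f i))         ≈⟨ sumF-cong (λ i → reflexive (sumF≡sum (f i))) ⟩
    sumF (λ i → sum (f i))          ≡⟨ sumF≡sum (λ i → sum (f i)) ⟩
    sum (λ i → sum (f i))           ≈⟨ ∑-comm f ⟩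
    sum (λ j → sum λ i → f i j)     ≡⟨ sumF≡sum (λ j → sum λ i → f i j) ⟨
    sumF (λ j → sum λ i → f i j)    ≈⟨ sumF-cong (λ j → reflexive (≡.sym (sumF≡sum λ i → f i j))) ⟩
    sumF (λ j → sumF λ i → f i j)   ∎

  module _ {m : ℕ} where
    ∙-congˡ : ∀ {c d : V m} β → c ≈v d → c ∙ β ≈ d ∙ β
    ∙-congˡ β c≈d = sumF-cong λ j → *-cong (c≈d j) refl

    ∙-congʳ : ∀ (c : V m) {β γ} → β ≈v γ → c ∙ β ≈ c ∙ γ
    ∙-congʳ c β≈γ = sumF-cong λ j → *-cong refl (β≈γ j)

    ∙-comm : ∀ (c β : V m) → c ∙ β ≈ β ∙ c
    ∙-comm c β = sumF-cong λ j → *-comm (c j) (β j)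

    0∙ : ∀ (β : V m) → 0v ∙ β ≈ 0#
    0∙ β = trans (sumF-cong λ j → zeroˡ (β j)) (sumF-0 {m})

    ∙-distribʳ-+ : ∀ (c d β : V m) → (c +ᵛ d) ∙ β ≈ c ∙ β + d ∙ β
    ∙-distribʳ-+ c d β = trans (sumF-cong λ j → distribʳ (β j) (c j) (d j)) (sumF-+ (λ j → c j * β j) (λ j → d j * β j))

    ∙-assocˡ : ∀ s (c β : V m) → (s ·ᵛ c) ∙ β ≈ s * (c ∙ β)
    ∙-assocˡ s c β = trans (sumF-cong λ j → *-assoc s (c j) (β j)) (sumF-*ˡ s λ j → c j * β j)

  module _ {m : ℕ} (p : Fin (suc m)) where
    ∙-removeAt : ∀ (c β : V (suc m)) → c ∙ β ≈ c p * β p + removeAt c p ∙ removeAt β p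
    ∙-removeAt c β = sumF-remove (λ j → c j * β j) p

    insertAt-∙ : ∀ (c : V m) s β → insertAt c p s ∙ β ≈ s * β p + c ∙ removeAt β p
    insertAt-∙ c s β = trans (∙-removeAt (insertAt c p s) β) (+-cong
      (*-cong (reflexive (insertAt-lookup c p s)) refl)
      (∙-congˡ (removeAt β p) λ j → reflexive (removeAt-insertAt c p s j)))

  unit-lookup : ∀ {m} (p : Fin m) → unit p p ≈ 1#
  unit-lookup {suc m} p = reflexive (insertAt-lookup 0v p 1#)

  unit-∙ : ∀ {m} (p : Fin m) β → unit p ∙ β ≈ β p
  unit-∙ {suc m} p β = begin
    unit p ∙ β                    ≈⟨ insertAt-∙ p 0v 1# β ⟩
    1# * β p + 0v ∙ removeAt β p  ≈⟨ +-cong (*-identityˡ (β p)) (0∙ (removeAt β p)) ⟩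
    β p + 0#                      ≈⟨ +-identityʳ (β p) ⟩
    β p                           ∎





  module _ {m n : ℕ} where
    lincomb-cong : ∀ {c d : V m} (b : Fin m → V n) → c ≈v d → lincomb c b ≈v lincomb d b
    lincomb-cong b c≈d i = ∙-congˡ ((b ᵀ) i) c≈d

    lincomb-congʳ : ∀ (c : V m) {a b : Fin m → V n} → (∀ j → a j ≈v b j) → lincomb c a ≈v lincomb c b
    lincomb-congʳ c a≈b i = ∙-congʳ c λ j → a≈b j i

    lincomb-+ : ∀ (c d : V m) (b : Fin m → V n) → lincomb (c +ᵛ d) b ≈v lincomb c b +ᵛ lincomb d b
    lincomb-+ c d b i = ∙-distribʳ-+ c d ((b ᵀ) i)

    lincomb-· : ∀ s (c : V m) (b : Fin m → V n) → lincomb (s ·ᵛ c) b ≈v s ·ᵛ lincomb c b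
    lincomb-· s c b i = ∙-assocˡ s c ((b ᵀ) i)

    lincomb-- : ∀ (c d : V m) (b : Fin m → V n) → lincomb (c -ᵛ d) b ≈v lincomb c b -ᵛ lincomb d b
    lincomb-- c d b i = trans (lincomb-+ c _ b i) (+-cong refl (lincomb-· (- 1#) d b i))

    lincomb-0 : ∀ (b : Fin m → V n) → lincomb 0v b ≈v 0v
    lincomb-0 b i = 0∙ ((b ᵀ) i)

  module _ {m n : ℕ} (p : Fin (suc m)) where
    lincomb-insertAt : ∀ (c : V m) s (b : Fin (suc m) → V n) →
                       lincomb (insertAt c p s) b ≈v s ·ᵛ b p +ᵛ lincomb c (removeAt b p)
    lincomb-insertAt c s b i = insertAt-∙ p c s ((b ᵀ) i)

  lincomb-removeAt : ∀ {m n} (p : Fin (suc m)) (c : V (suc m)) (b : Fin (suc m) → V n) →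
                     lincomb c b ≈v c p ·ᵛ b p +ᵛ lincomb (removeAt c p) (removeAt b p)
  lincomb-removeAt p c b i = ∙-removeAt p c ((b ᵀ) i)

  lincomb-unit : ∀ {m n} (p : Fin m) (b : Fin m → V n) → lincomb (unit p) b ≈v b p
  lincomb-unit p b i = unit-∙ p ((b ᵀ) i)

  lincomb-lincomb : ∀ {l m n} (c : V l) (M : Fin l → V m) (b : Fin m → V n) →
                    lincomb c (λ i → lincomb (M i) b) ≈v lincomb (lincomb c M) b
  lincomb-lincomb c M b t = begin
    sumF (λ i → c i * sumF λ j → M i j * b j t)   ≈⟨ sumF-cong (λ i → sym (sumF-*ˡ (c i) λ j → M i j * b j t)) ⟩
    sumF (λ i → sumF λ j → c i * (M i j * b j t)) ≈⟨ sumF-comm (λ i j → c i * (M i j * b j t)) ⟩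
    sumF (λ j → sumF λ i → c i * (M i j * b j t)) ≈⟨ sumF-cong (λ j → sumF-cong λ i → sym (*-assoc (c i) (M i j) (b j t))) ⟩
    sumF (λ j → sumF λ i → c i * M i j * b j t)   ≈⟨ sumF-cong (λ j → sumF-*ʳ (b j t) λ i → c i * M i j) ⟩
    sumF (λ j → sumF (λ i → c i * M i j) * b j t) ∎

  module _ {m n : ℕ} {b : Fin m → V n} where
    Span-resp : ∀ {x y} → x ≈v y → Span b x → Span b y
    Span-resp x≈y (c , x≈) = c , λ i → trans (sym (x≈y i)) (x≈ i)

    Span-+ : ∀ {x y} → Span b x → Span b y → Span b (x +ᵛ y)
    Span-+ (c , x≈) (d , y≈) = c +ᵛ d , λ i → trans (+-cong (x≈ i) (y≈ i)) (sym (lincomb-+ c d b i))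

    Span-· : ∀ s {x} → Span b x → Span b (s ·ᵛ x)
    Span-· s (c , x≈) = s ·ᵛ c , λ i → trans (*-cong refl (x≈ i)) (sym (lincomb-· s c b i))

    Span-- : ∀ {x y} → Span b x → Span b y → Span b (x -ᵛ y)
    Span-- x∈ y∈ = Span-+ x∈ (Span-· (- 1#) y∈)

  module _ {m n : ℕ} (b : Fin m → V n) where
    Span-0 : Span b 0v
    Span-0 = 0v , λ i → sym (lincomb-0 b i)

    Span-lincomb : ∀ c → Span b (lincomb c b)
    Span-lincomb c = c , λ _ → refl

    Span-member : ∀ j → Span b (b j)
    Span-member j = unit j , λ i → sym (lincomb-unit j b i)

  Span-⊆ : ∀ {l m n} {a : Fin l → V n} {b : Fin m → V n} → (∀ j → Span a (b j)) → Span b ⊆ Span a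
  Span-⊆ {a = a} {b} b⊆a x (c , x≈) = lincomb c M , λ i → begin
      x i                                  ≈⟨ x≈ i ⟩
      lincomb c b i                        ≈⟨ lincomb-congʳ c (proj₂ ∘ b⊆a) i ⟩
      lincomb c (λ j → lincomb (M j) a) i  ≈⟨ lincomb-lincomb c M a i ⟩
      lincomb (lincomb c M) a i            ∎
    where M = proj₁ ∘ b⊆a

  Span? : ∀ {m n} (b : Fin m → V n) x → Dec (Span b x)
  Span? b x = ∃-vector? (λ c → x ≈v lincomb c b)
    (λ c≈d x≈ i → trans (x≈ i) (lincomb-cong b c≈d i)) (λ c → x ≈v? lincomb c b)

  module _ {m n : ℕ} {b : Fin m → V n} (b-indep : LinIndep b) where
    LinIndep-unique : ∀ c d → lincomb c b ≈v lincomb d b → c ≈v d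
    LinIndep-unique c d c≈d j = x-y≈0⇒x≈y (b-indep (c -ᵛ d) c-d≈0 j)
      where
      c-d≈0 : lincomb (c -ᵛ d) b ≈v 0v
      c-d≈0 i = trans (lincomb-- c d b i)
        (trans (+-cong (c≈d i) (-1*x≈-x _)) (-‿inverseʳ (lincomb d b i)))

    LinIndep-≉0 : ∀ j → ¬ b j ≈v 0v
    LinIndep-≉0 j bj≈0 = 1≉0 (trans (sym (unit-lookup j))
      (b-indep (unit j) (λ i → trans (lincomb-unit j b i) (bj≈0 i)) j))

  ∉Span⇒coefficient≈0 : ∀ {m n} {b : Fin m → V n} {w r : V n} s →
                        ¬ Span b w → Span b (s ·ᵛ w +ᵛ r) → Span b r → s ≈ 0#
  ∉Span⇒coefficient≈0 {w = w} {r} s w∉ sw+r∈ r∈ with s ≈? 0#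
  ... | yes s≈0 = s≈0
  ... | no s≉0 = ⊥-elim (w∉ (Span-resp w≈ (Span-· (inv s s≉0) (Span-- sw+r∈ r∈))))
    where
    w≈ : inv s s≉0 ·ᵛ (s ·ᵛ w +ᵛ r -ᵛ r) ≈v w
    w≈ i = trans (*-cong refl (x+y-y≈x (s * w i) (r i))) (inv-cancelˡ s s≉0 (w i))

  LinIndep-∷ : ∀ {m n} {b : Fin m → V n} {w : V n} → LinIndep b → ¬ Span b w → LinIndep (w ∷ b)
  LinIndep-∷ {b = b} {w} b-indep w∉ c c·w∷b≈0 = λ where
      zero → c₀≈0
      (suc j) → b-indep (c ∘ suc) rest≈0 j
    where
    c₀≈0 : c zero ≈ 0#
    c₀≈0 = ∉Span⇒coefficient≈0 (c zero) w∉
      (Span-resp (λ i → sym (c·w∷b≈0 i)) (Span-0 b)) (Span-lincomb b (c ∘ suc))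
    rest≈0 : lincomb (c ∘ suc) b ≈v 0v
    rest≈0 i = begin
      lincomb (c ∘ suc) b i                          ≈⟨ +-identityˡ _ ⟨
      0# + lincomb (c ∘ suc) b i                     ≈⟨ +-cong (trans (*-cong c₀≈0 refl) (zeroˡ (w i))) refl ⟨
      c zero * w i + lincomb (c ∘ suc) b i           ≈⟨ c·w∷b≈0 i ⟩
      0#                                             ∎

  shear : ∀ {m n} (p : Fin (suc m)) → V m → (Fin (suc m) → V n) → Fin m → V n
  shear p t b i = removeAt b p i +ᵛ t i ·ᵛ b p

  module _ {m n : ℕ} (p : Fin (suc m)) (t : V m) (b : Fin (suc m) → V n) where
    lincomb-shear : ∀ c → lincomb c (shear p t b) ≈v lincomb (insertAt c p (c ∙ t)) b
    lincomb-shear c i = begin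
      sumF (λ j → c j * (removeAt b p j i + t j * b p i))
        ≈⟨ sumF-cong (λ j → distribˡ (c j) _ _) ⟩
      sumF (λ j → c j * removeAt b p j i + c j * (t j * b p i))
        ≈⟨ sumF-+ (λ j → c j * removeAt b p j i) (λ j → c j * (t j * b p i)) ⟩
      lincomb c (removeAt b p) i + sumF (λ j → c j * (t j * b p i))
        ≈⟨ +-cong refl (trans (sumF-cong λ j → sym (*-assoc (c j) (t j) (b p i))) (sumF-*ʳ (b p i) λ j → c j * t j)) ⟩
      lincomb c (removeAt b p) i + (c ∙ t) * b p i
        ≈⟨ +-comm _ _ ⟩
      (c ∙ t) * b p i + lincomb c (removeAt b p) i
        ≈⟨ lincomb-insertAt p c (c ∙ t) b i ⟨
      lincomb (insertAt c p (c ∙ t)) b i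
        ∎

    shear-LinIndep : LinIndep b → LinIndep (shear p t b)
    shear-LinIndep b-indep c c·shear≈0 j = begin
      c j                             ≡⟨ insertAt-punchIn c p (c ∙ t) j ⟨
      insertAt c p (c ∙ t) (punchIn p j) ≈⟨ b-indep (insertAt c p (c ∙ t)) (λ i → trans (sym (lincomb-shear c i)) (c·shear≈0 i)) (punchIn p j) ⟩
      0#                              ∎

    shear-⊆Span : ∀ i → Span b (shear p t b i)
    shear-⊆Span i = Span-+ {b = b} (Span-member b (punchIn p i)) (Span-· {b = b} (t i) (Span-member b p))

  Hyperplane : ∀ {m n} → (Fin m → V n) → V m → VSet n
  Hyperplane b β x = ∃ λ c → x ≈v lincomb c b × c ∙ β ≈ 0#

  -- kernelBasis b spans the vectors whose coordinates with respect to b are annihilated by β. For β the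
  -- first column of b it is a step of Gaussian elimination.
  module Kernel {m : ℕ} (β : V (suc m)) (p : Fin (suc m)) (βp≉0 : β p ≉ 0#) where
    ν : Carrier
    ν = - inv (β p) βp≉0

    ν*βp≈-1 : ν * β p ≈ - 1#
    ν*βp≈-1 = trans (sym (-‿distribˡ-* _ (β p))) (-‿cong (*-inverseˡ (β p) βp≉0))

    shift : V m
    shift = ν ·ᵛ removeAt β p

    ∙-shift : ∀ c → c ∙ shift ≈ ν * (c ∙ removeAt β p)
    ∙-shift c = trans (∙-comm c shift) (trans (∙-assocˡ ν (removeAt β p) c) (*-cong refl (∙-comm _ c)))

    shift-cancels : ∀ i → β (punchIn p i) + shift i * β p ≈ 0#
    shift-cancels i = begin
      β′ + ν * β′ * β p       ≈⟨ +-cong refl (solve 3 (λ x y z → x :* y :* z := (x :* z) :* y) refl ν β′ (β p)) ⟩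
      β′ + ν * β p * β′       ≈⟨ +-cong refl (*-cong ν*βp≈-1 refl) ⟩
      β′ + (- 1#) * β′        ≈⟨ +-cong refl (-1*x≈-x β′) ⟩
      β′ - β′                 ≈⟨ -‿inverseʳ β′ ⟩
      0#                      ∎
      where β′ = β (punchIn p i)

    insertAt-shift-∙ : ∀ c → insertAt c p (c ∙ shift) ∙ β ≈ 0#
    insertAt-shift-∙ c = begin
      insertAt c p (c ∙ shift) ∙ β  ≈⟨ insertAt-∙ p c (c ∙ shift) β ⟩
      c ∙ shift * β p + S           ≈⟨ +-cong (*-cong (∙-shift c) refl) refl ⟩
      ν * S * β p + S               ≈⟨ +-cong (solve 3 (λ x y z → x :* y :* z := (x :* z) :* y) refl ν S (β p)) refl ⟩
      ν * β p * S + S               ≈⟨ +-cong (trans (*-cong ν*βp≈-1 refl) (-1*x≈-x S)) refl ⟩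
      - S + S                       ≈⟨ -‿inverseˡ S ⟩
      0#                            ∎
      where S = c ∙ removeAt β p

    ∙≈0⇒pivot : ∀ c → c ∙ β ≈ 0# → c p ≈ removeAt c p ∙ shift
    ∙≈0⇒pivot c c∙β≈0 = sym (begin
      removeAt c p ∙ shift        ≈⟨ ∙-shift (removeAt c p) ⟩
      ν * S                       ≈⟨ *-cong refl S≈ ⟩
      ν * ((- 1#) * (c p * β p))  ≈⟨ solve 4 (λ x y u v → x :* (y :* (u :* v)) := (x :* v) :* y :* u) refl ν (- 1#) (c p) (β p) ⟩
      ν * β p * (- 1#) * c p      ≈⟨ *-cong (trans (*-cong ν*βp≈-1 refl) (-1*x≈-x (- 1#))) refl ⟩
      - (- 1#) * c p              ≈⟨ *-cong (⁻¹-involutive 1#) refl ⟩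
      1# * c p                    ≈⟨ *-identityˡ (c p) ⟩
      c p                         ∎)
      where
      S = removeAt c p ∙ removeAt β p
      S≈ : S ≈ (- 1#) * (c p * β p)
      S≈ = trans (inverseʳ-unique (c p * β p) S (trans (sym (∙-removeAt p c β)) c∙β≈0))
                 (sym (-1*x≈-x _))

    module _ {n : ℕ} (b : Fin (suc m) → V n) where
      kernelBasis : Fin m → V n
      kernelBasis = shear p shift b

      kernelBasis-LinIndep : LinIndep b → LinIndep kernelBasis
      kernelBasis-LinIndep = shear-LinIndep p shift b

      Span-kernelBasis : Span kernelBasis ≐ Hyperplane b β
      Span-kernelBasis = ⊆H , ⊇H
        where
        ⊆H : Span kernelBasis ⊆ Hyperplane b β
        ⊆H x (c , x≈) = insertAt c p (c ∙ shift) ,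
          (λ i → trans (x≈ i) (lincomb-shear p shift b c i)) , insertAt-shift-∙ c
        ⊇H : Hyperplane b β ⊆ Span kernelBasis
        ⊇H x (c , x≈ , c∙β≈0) = removeAt c p , λ i → begin
          x i                                                  ≈⟨ x≈ i ⟩
          lincomb c b i                                        ≈⟨ lincomb-removeAt p c b i ⟩
          c p * b p i + lincomb c′ (removeAt b p) i            ≈⟨ +-cong (*-cong (∙≈0⇒pivot c c∙β≈0) refl) refl ⟩
          c′ ∙ shift * b p i + lincomb c′ (removeAt b p) i     ≈⟨ lincomb-insertAt p c′ (c′ ∙ shift) b i ⟨
          lincomb (insertAt c′ p (c′ ∙ shift)) b i             ≈⟨ lincomb-shear p shift b c′ i ⟨
          lincomb c′ kernelBasis i                             ∎
          where c′ = removeAt c p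

  LinIndep-tail : ∀ {m d} (g : Fin m → V (suc d)) → (∀ i → g i zero ≈ 0#) → LinIndep g → LinIndep (tail ∘ g)
  LinIndep-tail {m} g g₀≈0 g-indep c c·tail≈0 = g-indep c λ where
    zero → trans (sumF-cong λ j → trans (*-cong refl (g₀≈0 j)) (zeroʳ (c j))) (sumF-0 {m})
    (suc i) → c·tail≈0 i

  LinIndep⇒≤ : ∀ {m d} (r : Fin m → V d) → LinIndep r → m ≤ d
  LinIndep⇒≤ {zero} r _ = z≤n
  LinIndep⇒≤ {suc m} {zero} r r-indep = ⊥-elim (1≉0 (r-indep (λ _ → 1#) (λ ()) zero))
  LinIndep⇒≤ {suc m} {suc d} r r-indep with ∀⊎∃¬ (λ i → r i zero ≈ 0#) (λ i → r i zero ≈? 0#)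
  ... | inj₁ r₀≈0 = m≤n⇒m≤1+n (LinIndep⇒≤ (tail ∘ r) (LinIndep-tail r r₀≈0 r-indep))
  ... | inj₂ (p , rp≉0) = s≤s (LinIndep⇒≤ (tail ∘ g) (LinIndep-tail g shift-cancels (kernelBasis-LinIndep r r-indep)))
    where
    open Kernel ((r ᵀ) zero) p rp≉0
    g = kernelBasis r

  LinIndep-⊆Span⇒≤ : ∀ {l m n} {a : Fin l → V n} {b : Fin m → V n} →
                     LinIndep a → (∀ i → Span b (a i)) → l ≤ m
  LinIndep-⊆Span⇒≤ {a = a} {b} a-indep a⊆b = LinIndep⇒≤ M M-indep
    where
    M = proj₁ ∘ a⊆b
    M-indep : LinIndep M
    M-indep c c·M≈0 = a-indep c λ i → begin
      lincomb c a i                        ≈⟨ lincomb-congʳ c (proj₂ ∘ a⊆b) i ⟩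
      lincomb c (λ j → lincomb (M j) b) i  ≈⟨ lincomb-lincomb c M b i ⟩
      lincomb (lincomb c M) b i            ≈⟨ lincomb-cong b c·M≈0 i ⟩
      lincomb 0v b i                       ≈⟨ lincomb-0 b i ⟩
      0#                                   ∎

  LinIndep⇒⊇Span : ∀ {m n} {a b : Fin m → V n} → LinIndep a → (∀ i → Span b (a i)) → Span b ⊆ Span a
  LinIndep⇒⊇Span {a = a} {b} a-indep a⊆b x x∈b with Span? a x
  ... | yes x∈a = x∈a
  ... | no x∉a = ⊥-elim (n≮n _ (LinIndep-⊆Span⇒≤ {a = x ∷ a} (LinIndep-∷ a-indep x∉a) λ where
          zero → x∈b
          (suc i) → a⊆b i))

  HasDim-∩-hyperplanes : ∀ {m n} {B : Fin (suc (suc m)) → V n} {a b : Fin (suc m) → V n} →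
             LinIndep a → LinIndep b → (∀ j → Span B (a j)) → (∀ j → Span B (b j)) →
             ∀ j → ¬ Span b (a j) → HasDim (Span a ∩ Span b) m
  HasDim-∩-hyperplanes {m} {n} {B} {a} {b} a-indep b-indep a⊆B b⊆B j aj∉b =
    kernelBasis a , kernelBasis-LinIndep a a-indep ,
    (λ x x∈ → proj₂ (Span-kernelBasis a) x (H⊇ x x∈)) , (λ x x∈ → H⊆ x (proj₁ (Span-kernelBasis a) x x∈))
    where
    w∷b : Fin (suc (suc m)) → V n
    w∷b = a j ∷ b
    w∷b-indep : LinIndep w∷b
    w∷b-indep = LinIndep-∷ {b = b} b-indep aj∉b
    a⊆w∷b : ∀ l → Span w∷b (a l)
    a⊆w∷b l = LinIndep⇒⊇Span {a = w∷b} {B} w∷b-indep (λ where zero → a⊆B j ; (suc i) → b⊆B i) (a l) (a⊆B l)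
    A : Fin (suc m) → V (suc (suc m))
    A = proj₁ ∘ a⊆w∷b
    coordinates : ∀ c → lincomb c a ≈v lincomb (lincomb c A) w∷b
    coordinates c i = trans (lincomb-congʳ c (proj₂ ∘ a⊆w∷b) i) (lincomb-lincomb c A w∷b i)
    β : V (suc m)
    β l = A l zero
    βj≈1 : β j ≈ 1#
    βj≈1 = LinIndep-unique {b = w∷b} w∷b-indep (A j) (unit zero)
             (λ i → trans (sym (proj₂ (a⊆w∷b j) i)) (sym (lincomb-unit zero w∷b i))) zero
    open Kernel β j (λ βj≈0 → 1≉0 (trans (sym βj≈1) βj≈0))
    H⊆ : Hyperplane a β ⊆ (Span a ∩ Span b)
    H⊆ x (c , x≈ , c∙β≈0) = (c , x≈) , (lincomb c A ∘ suc) , λ i → begin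
      x i                                                    ≈⟨ x≈ i ⟩
      lincomb c a i                                          ≈⟨ coordinates c i ⟩
      c ∙ β * a j i + lincomb (lincomb c A ∘ suc) b i        ≈⟨ +-cong (trans (*-cong c∙β≈0 refl) (zeroˡ _)) refl ⟩
      0# + lincomb (lincomb c A ∘ suc) b i                   ≈⟨ +-identityˡ _ ⟩
      lincomb (lincomb c A ∘ suc) b i                        ∎
    H⊇ : (Span a ∩ Span b) ⊆ Hyperplane a β
    H⊇ x ((c , x≈ca) , (d , x≈db)) = c , x≈ca , LinIndep-unique {b = w∷b} w∷b-indep (lincomb c A) (0# ∷ d) same zero
      where
      same : lincomb (lincomb c A) w∷b ≈v lincomb (0# ∷ d) w∷b
      same i = begin
        lincomb (lincomb c A) w∷b i       ≈⟨ coordinates c i ⟨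
        lincomb c a i                     ≈⟨ trans (sym (x≈ca i)) (x≈db i) ⟩
        lincomb d b i                     ≈⟨ +-identityˡ _ ⟨
        0# + lincomb d b i                ≈⟨ +-cong (zeroˡ (a j i)) refl ⟨
        0# * a j i + lincomb d b i        ∎

  module _ {m : ℕ} {β γ : V m} {r : Fin m} (βr≉0 : β r ≉ 0#) where
    private
      combination-∙ : ∀ l s (δ : V m) → (unit l -ᵛ s ·ᵛ unit r) ∙ δ ≈ δ l + (- 1#) * (s * δ r)
      combination-∙ l s δ = begin
        (unit l -ᵛ s ·ᵛ unit r) ∙ δ             ≈⟨ ∙-distribʳ-+ (unit l) _ δ ⟩
        unit l ∙ δ + ((- 1#) ·ᵛ s ·ᵛ unit r) ∙ δ ≈⟨ +-cong (unit-∙ l δ) (∙-assocˡ (- 1#) _ δ) ⟩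
        δ l + (- 1#) * ((s ·ᵛ unit r) ∙ δ)       ≈⟨ +-cong refl (*-cong refl (trans (∙-assocˡ s (unit r) δ) (*-cong refl (unit-∙ r δ)))) ⟩
        δ l + (- 1#) * (s * δ r)                 ∎

    ker⊆ker⇒proportional : (∀ c → c ∙ β ≈ 0# → c ∙ γ ≈ 0#) → γ ≈v (γ r * inv (β r) βr≉0) ·ᵛ β
    ker⊆ker⇒proportional ker⊆ker l = begin
      γ l                      ≈⟨ x-y≈0⇒x≈y (trans (sym (combination-∙ l s γ)) (ker⊆ker c c∙β≈0)) ⟩
      s * γ r                  ≈⟨ solve 3 (λ x y z → (x :* y) :* z := (z :* y) :* x) refl (β l) (inv (β r) βr≉0) (γ r) ⟩
      γ r * inv (β r) βr≉0 * β l ∎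
      where
      s = β l * inv (β r) βr≉0
      c = unit l -ᵛ s ·ᵛ unit r
      c∙β≈0 : c ∙ β ≈ 0#
      c∙β≈0 = begin
        c ∙ β                        ≈⟨ combination-∙ l s β ⟩
        β l + (- 1#) * (s * β r)     ≈⟨ +-cong refl (*-cong refl (solve 3 (λ x y z → (x :* y) :* z := x :* (z :* y)) refl (β l) (inv (β r) βr≉0) (β r))) ⟩
        β l + (- 1#) * (β l * (β r * inv (β r) βr≉0)) ≈⟨ +-cong refl (*-cong refl (trans (*-cong refl (*-inverseʳ (β r) βr≉0)) (*-identityʳ (β l)))) ⟩
        β l + (- 1#) * β l           ≈⟨ +-cong refl (-1*x≈-x (β l)) ⟩
        β l - β l                    ≈⟨ -‿inverseʳ (β l) ⟩
        0#                           ∎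

  module _ {k n : ℕ} (γ : Fin n → V (suc k)) (γ≉0 : ∀ i → ¬ γ i ≈v 0v) (n<2^k : n < 2 ^ k)
           {a : V (suc k)} {p : Fin (suc k)} (ap≉0 : a p ≉ 0#) where
    private
      bit : Fin 2 → Carrier
      bit zero = 0#
      bit (suc _) = 1#

      bit-injective : ∀ x y → bit x ≈ bit y → x ≡ y
      bit-injective zero zero _ = ≡.refl
      bit-injective zero (suc zero) 0≈1 = ⊥-elim (1≉0 (sym 0≈1))
      bit-injective (suc zero) zero 1≈0 = ⊥-elim (1≉0 1≈0)
      bit-injective (suc zero) (suc zero) _ = ≡.refl

      bits : Fin (2 ^ k) → V k
      bits x = bit ∘ finToFun x

      candidate : Fin (2 ^ k) → V (suc k)
      candidate x = insertAt (bits x) p (inv (a p) ap≉0 * (1# - removeAt a p ∙ bits x))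

      a∙candidate≈1 : ∀ x → a ∙ candidate x ≈ 1#
      a∙candidate≈1 x = begin
        a ∙ candidate x                      ≈⟨ ∙-comm a (candidate x) ⟩
        candidate x ∙ a                      ≈⟨ insertAt-∙ p (bits x) _ a ⟩
        inv (a p) ap≉0 * (1# - T) * a p + bits x ∙ removeAt a p
                                             ≈⟨ +-cong (solve 3 (λ x y z → x :* y :* z := y :* (x :* z)) refl (inv (a p) ap≉0) (1# - T) (a p)) (∙-comm (bits x) _) ⟩
        (1# - T) * (inv (a p) ap≉0 * a p) + T ≈⟨ +-cong (trans (*-cong refl (*-inverseˡ (a p) ap≉0)) (*-identityʳ _)) refl ⟩
        1# - T + T                           ≈⟨ +-assoc 1# (- T) T ⟩
        1# + (- T + T)                       ≈⟨ +-cong refl (-‿inverseˡ T) ⟩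
        1# + 0#                              ≈⟨ +-identityʳ 1# ⟩
        1#                                   ∎
        where T = removeAt a p ∙ bits x

      candidate-injective : ∀ x y → candidate x ≈v candidate y → x ≡ y
      candidate-injective x y cx≈cy = finToFun-injective x y λ l → bit-injective _ _ (begin
        bits x l                      ≡⟨ insertAt-punchIn (bits x) p _ l ⟨
        candidate x (punchIn p l)     ≈⟨ cx≈cy (punchIn p l) ⟩
        candidate y (punchIn p l)     ≡⟨ insertAt-punchIn (bits y) p _ l ⟩
        bits y l                      ∎)

      -- The first clause is junk: if a ∙ γ i ≈ 0, no β with a ∙ β ≈ 1 has ker β ⊆ ker γ i.
      normalised : Fin n → V (suc k)
      normalised i with a ∙ γ i ≈? 0#
      ... | yes _ = γ i
      ... | no a∙γi≉0 = inv (a ∙ γ i) a∙γi≉0 ·ᵛ γ i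

      forced : ∀ β → a ∙ β ≈ 1# → ∀ i → (∀ c → c ∙ β ≈ 0# → c ∙ γ i ≈ 0#) → β ≈v normalised i
      forced β a∙β≈1 i ker⊆ker with ∀⊎∃¬ (λ l → β l ≈ 0#) (λ l → β l ≈? 0#)
      ... | inj₁ β≈0 = ⊥-elim (1≉0 (trans (sym a∙β≈1) (trans (∙-comm a β) (trans (∙-congˡ a β≈0) (0∙ a)))))
      ... | inj₂ (r , βr≉0) = multiple-of-β _ (ker⊆ker⇒proportional βr≉0 ker⊆ker)
        where
        a∙multiple : ∀ λ′ → γ i ≈v λ′ ·ᵛ β → a ∙ γ i ≈ λ′
        a∙multiple λ′ γi≈ = begin
          a ∙ γ i          ≈⟨ ∙-congʳ a γi≈ ⟩
          a ∙ (λ′ ·ᵛ β)    ≈⟨ ∙-comm a (λ′ ·ᵛ β) ⟩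
          (λ′ ·ᵛ β) ∙ a    ≈⟨ ∙-assocˡ λ′ β a ⟩
          λ′ * β ∙ a       ≈⟨ *-cong refl (trans (∙-comm β a) a∙β≈1) ⟩
          λ′ * 1#          ≈⟨ *-identityʳ λ′ ⟩
          λ′               ∎
        multiple-of-β : ∀ λ′ → γ i ≈v λ′ ·ᵛ β → β ≈v normalised i
        multiple-of-β λ′ γi≈ with a ∙ γ i ≈? 0#
        ... | yes a∙γi≈0 = ⊥-elim (γ≉0 i λ l →
          trans (γi≈ l) (trans (*-cong (trans (sym (a∙multiple λ′ γi≈)) a∙γi≈0) refl) (zeroˡ (β l))))
        ... | no a∙γi≉0 = λ l → sym (begin
          inv (a ∙ γ i) a∙γi≉0 * γ i l        ≈⟨ *-cong refl (γi≈ l) ⟩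
          inv (a ∙ γ i) a∙γi≉0 * (λ′ * β l)   ≈⟨ *-cong refl (*-cong (sym (a∙multiple λ′ γi≈)) refl) ⟩
          inv (a ∙ γ i) a∙γi≉0 * (a ∙ γ i * β l) ≈⟨ inv-cancelˡ (a ∙ γ i) a∙γi≉0 (β l) ⟩
          β l                                  ∎)

    -- Pigeonhole: the 2^k candidates are distinct, and coordinate i forces only normalised i.
    generic-functional : ∃ λ β → a ∙ β ≉ 0# × ∀ i → ¬ (∀ c → c ∙ β ≈ 0# → c ∙ γ i ≈ 0#)
    generic-functional
      with ∀⊎∃¬ (λ x → ∃ λ i → candidate x ≈v normalised i) (λ x → Fin.any? λ i → candidate x ≈v? normalised i)
    ... | inj₂ (x , ¬forced) =
      candidate x , (λ a∙≈0 → 1≉0 (trans (sym (a∙candidate≈1 x)) a∙≈0)) ,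
      λ i ker⊆ker → ¬forced (i , forced (candidate x) (a∙candidate≈1 x) i ker⊆ker)
    ... | inj₁ all-forced
      with x , y , x<y , fx≡fy ← Fin.pigeonhole n<2^k (proj₁ ∘ all-forced) =
      ⊥-elim (Fin.<⇒≢ x<y (candidate-injective x y λ l →
        trans (proj₂ (all-forced x) l)
          (trans (reflexive (≡.cong (λ i → normalised i l) fx≡fy)) (sym (proj₂ (all-forced y) l)))))

  HasDim-resp : ∀ {n d} {W X : VSet n} → W ⊆ X → X ⊆ W → HasDim W d → HasDim X d
  HasDim-resp W⊆X X⊆W (b , b-indep , W⊆b , b⊆W) =
    b , b-indep , (λ x x∈X → W⊆b x (X⊆W x x∈X)) , (λ x x∈b → W⊆X x (b⊆W x x∈b))

  ∩-⊆-hyperplane : ∀ {l m n} {B : Fin l → V n} {b : Fin (suc m) → V n} {z : Fin m → V n} {w : V n} →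
                   LinIndep z → (∀ i → Span b (z i)) → (∀ i → Span B (z i)) →
                   Span b w → ¬ Span B w → (Span b ∩ Span B) ⊆ Span z
  ∩-⊆-hyperplane {B = B} {b} {z} {w} z-indep z⊆b z⊆B w∈b w∉B x (x∈b , x∈B) =
    Span-resp x≈ (Span-lincomb z (d ∘ suc))
    where
    w∉z : ¬ Span z w
    w∉z w∈z = w∉B (Span-⊆ z⊆B w w∈z)
    x∈w∷z : Span (w ∷ z) x
    x∈w∷z = LinIndep⇒⊇Span {a = w ∷ z} {b} (LinIndep-∷ {b = z} z-indep w∉z)
      (λ where zero → w∈b ; (suc i) → z⊆b i) x x∈b
    d = proj₁ x∈w∷z
    d₀≈0 : d zero ≈ 0#
    d₀≈0 = ∉Span⇒coefficient≈0 (d zero) w∉B (Span-resp (proj₂ x∈w∷z) x∈B)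
             (Span-⊆ z⊆B _ (Span-lincomb z (d ∘ suc)))
    x≈ : lincomb (d ∘ suc) z ≈v x
    x≈ i = sym (begin
      x i                                       ≈⟨ proj₂ x∈w∷z i ⟩
      d zero * w i + lincomb (d ∘ suc) z i      ≈⟨ +-cong (trans (*-cong d₀≈0 refl) (zeroˡ (w i))) refl ⟩
      0# + lincomb (d ∘ suc) z i                ≈⟨ +-identityˡ _ ⟩
      lincomb (d ∘ suc) z i                     ∎)

  module _ {n m : ℕ} {U : VSet n} (U-dim : HasDim U (suc (suc m))) (U-nc : NotInCoordHyperplane U) where
    private
      B : Fin (suc (suc m)) → V n
      B = proj₁ U-dim
      B-indep : LinIndep B
      B-indep = proj₁ (proj₂ U-dim)
      U⊆B : U ⊆ Span B
      U⊆B = proj₁ (proj₂ (proj₂ U-dim))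
      B⊆U : Span B ⊆ U
      B⊆U = proj₂ (proj₂ (proj₂ U-dim))

      spanned-⊆B : ∀ {l} {b : Fin l → V n} {W : VSet n} → W ⊆ U → Span b ⊆ W → ∀ j → Span B (b j)
      spanned-⊆B {b = b} W⊆U b⊆W j = U⊆B _ (W⊆U _ (b⊆W _ (Span-member b j)))

    SubsC-adjacent : ∀ W X → SubsC n (suc m) U W → SubsC n (suc m) U X → ¬ W ≐ X → Adjacent n (suc m) W X
    SubsC-adjacent W X (W⊆U , (bw , bw-indep , W⊆bw , bw⊆W) , _) (X⊆U , (bx , bx-indep , X⊆bx , bx⊆X) , _) W≉X
      with ∀⊎∃¬ (λ j → Span bx (bw j)) (λ j → Span? bx (bw j))
         | ∀⊎∃¬ (λ j → Span bw (bx j)) (λ j → Span? bw (bx j))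
    ... | inj₂ (j , bwj∉bx) | _ =
      HasDim-resp (λ x (x∈bw , x∈bx) → bw⊆W x x∈bw , bx⊆X x x∈bx) (λ x (x∈W , x∈X) → W⊆bw x x∈W , X⊆bx x x∈X)
        (HasDim-∩-hyperplanes {B = B} {bw} {bx} bw-indep bx-indep (spanned-⊆B W⊆U bw⊆W) (spanned-⊆B X⊆U bx⊆X) j bwj∉bx)
    ... | inj₁ _ | inj₂ (j , bxj∉bw) =
      HasDim-resp (λ x (x∈bx , x∈bw) → bw⊆W x x∈bw , bx⊆X x x∈bx) (λ x (x∈W , x∈X) → X⊆bx x x∈X , W⊆bw x x∈W)
        (HasDim-∩-hyperplanes {B = B} {bx} {bw} bx-indep bw-indep (spanned-⊆B X⊆U bx⊆X) (spanned-⊆B W⊆U bw⊆W) j bxj∉bw)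
    ... | inj₁ bw⊆bx | inj₁ bx⊆bw = ⊥-elim (W≉X
      ( (λ x x∈W → bx⊆X x (Span-⊆ {a = bx} {bw} bw⊆bx x (W⊆bw x x∈W)))
      , (λ x x∈X → bw⊆W x (Span-⊆ {a = bw} {bx} bx⊆bw x (X⊆bx x x∈X)))))

    SubsC-clique : IsClique n (suc m) (SubsC n (suc m) U)
    SubsC-clique = (λ W → proj₂) , SubsC-adjacent

    private
      coordinate≉0 : ∀ i → ¬ (B ᵀ) i ≈v 0v
      coordinate≉0 i Bᵢ≈0 = U-nc i λ x x∈U →
        let (c , x≈) = U⊆B x x∈U in trans (x≈ i) (trans (∙-congʳ c Bᵢ≈0) (trans (∙-comm c 0v) (0∙ c)))

    avoiding-hyperplane : n < 2 ^ suc m → ∀ y → U y → ¬ y ≈v 0v →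
                          ∃ λ X → SubsC n (suc m) U X × ¬ X y
    avoiding-hyperplane n<2^k y y∈U y≉0 with U⊆B y y∈U
    ... | a , y≈aB with ∀⊎∃¬ (λ l → a l ≈ 0#) (λ l → a l ≈? 0#)
    ...   | inj₁ a≈0 = ⊥-elim (y≉0 λ i → trans (y≈aB i) (trans (lincomb-cong B a≈0 i) (lincomb-0 B i)))
    ...   | inj₂ (p , ap≉0) with generic-functional (B ᵀ) coordinate≉0 n<2^k {a} {p} ap≉0
    ...     | β , a∙β≉0 , ker⊈ with ∀⊎∃¬ (λ l → β l ≈ 0#) (λ l → β l ≈? 0#)
    ...       | inj₁ β≈0 = ⊥-elim (a∙β≉0 (trans (∙-congʳ a β≈0) (trans (∙-comm a 0v) (0∙ a))))
    ...       | inj₂ (r , βr≉0) =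
      Span g , (X⊆U , (g , kernelBasis-LinIndep B B-indep , (λ _ x∈ → x∈) , (λ _ x∈ → x∈)) , X⊈C) , y∉X
      where
      open Kernel β r βr≉0
      g = kernelBasis B
      X⊆U : Span g ⊆ U
      X⊆U x x∈X = B⊆U x (Span-⊆ {a = B} {g} (shear-⊆Span r shift B) x x∈X)
      X⊈C : NotInCoordHyperplane (Span g)
      X⊈C i X⊆Cᵢ = ker⊈ i λ c c∙β≈0 →
        X⊆Cᵢ (lincomb c B) (proj₂ (Span-kernelBasis B) _ (c , (λ _ → refl) , c∙β≈0))
      y∉X : ¬ Span g y
      y∉X y∈X with proj₁ (Span-kernelBasis B) y y∈X
      ... | c , y≈cB , c∙β≈0 = a∙β≉0 (trans (∙-congˡ β a≈c) c∙β≈0)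
        where a≈c = LinIndep-unique {b = B} B-indep a c λ i → trans (sym (y≈aB i)) (y≈cB i)

    adjacent-to-all⇒⊆U : n < 2 ^ suc m → 0 < m → ∀ W → Vertex n (suc m) W →
                         (∀ X → SubsC n (suc m) U X → ¬ X ≐ W → Adjacent n (suc m) W X) → W ⊆ U
    adjacent-to-all⇒⊆U n<2^k 0<m W ((bw , bw-indep , W⊆bw , bw⊆W) , _) adjacent
      with ∀⊎∃¬ (λ j → Span B (bw j)) (λ j → Span? B (bw j))
    ... | inj₁ bw⊆B = λ x x∈W → B⊆U x (Span-⊆ {a = B} {bw} bw⊆B x (W⊆bw x x∈W))
    ... | inj₂ (j , w∉B) = ⊥-elim (no-nonzero-in-W∩U nonzero-in-W∩U)
      where
      distinct : ∀ X → X ⊆ U → ¬ X ≐ W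
      distinct X X⊆U (_ , W⊆X) = w∉B (U⊆B _ (X⊆U _ (W⊆X _ (bw⊆W _ (Span-member bw j)))))

      W∩U⊆ : ∀ X → SubsC n (suc m) U X → ∀ y → W y → U y → X y
      W∩U⊆ X (X⊆U , X-vertex) y y∈W y∈U with adjacent X (X⊆U , X-vertex) (distinct X X⊆U)
      ... | z , z-indep , W∩X⊆z , z⊆W∩X =
        proj₂ (z⊆W∩X y (∩-⊆-hyperplane {B = B} {bw} {z} z-indep
          (λ i → W⊆bw _ (proj₁ (z∈W∩X i))) (λ i → U⊆B _ (X⊆U _ (proj₂ (z∈W∩X i))))
          (Span-member bw j) w∉B y (W⊆bw y y∈W , U⊆B y y∈U)))
        where
        z∈W∩X : ∀ i → (W ∩ X) (z i)
        z∈W∩X i = z⊆W∩X (z i) (Span-member z i)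

      nonzero-in-W∩U : ∃ λ y → W y × U y × ¬ y ≈v 0v
      nonzero-in-W∩U
        with X₀ , (X₀⊆U , X₀-vertex) , _ ← avoiding-hyperplane n<2^k (B zero)
               (B⊆U _ (Span-member B zero)) (LinIndep-≉0 {b = B} B-indep zero)
        with y , y-indep , _ , y⊆W∩X₀ ← adjacent X₀ (X₀⊆U , X₀-vertex) (distinct X₀ X₀⊆U)
        = let y₀∈W∩X₀ = y⊆W∩X₀ _ (Span-member y i₀) in
          y i₀ , proj₁ y₀∈W∩X₀ , X₀⊆U _ (proj₂ y₀∈W∩X₀) , LinIndep-≉0 {b = y} y-indep i₀
        where i₀ = fromℕ< 0<m

      no-nonzero-in-W∩U : ¬ ∃ λ y → W y × U y × ¬ y ≈v 0v
      no-nonzero-in-W∩U (y , y∈W , y∈U , y≉0) with avoiding-hyperplane n<2^k y y∈U y≉0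
      ... | X , X∈ , y∉X = y∉X (W∩U⊆ X X∈ y y∈W y∈U)

    SubsC-maximal-clique : n < 2 ^ suc m → 0 < m → IsMaximalClique n (suc m) (SubsC n (suc m) U)
    SubsC-maximal-clique n<2^k 0<m =
      SubsC-clique , λ W W-vertex adjacent → adjacent-to-all⇒⊆U n<2^k 0<m W W-vertex adjacent , W-vertex

open import Data.Nat using (_+_; _∸_; _*_; s<s⁻¹)
open import Data.Nat.Properties using (≤-refl; *-suc; +-mono-≤; *-monoʳ-≤; m^n>0; +-identityʳ; <-≤-trans)

2*n≤2^n : ∀ n → 2 * n ≤ 2 ^ n
2*n≤2^n zero = z≤n
2*n≤2^n (suc zero) = ≤-refl
2*n≤2^n (suc (suc n)) = begin
  2 * suc (suc n)          ≡⟨ *-suc 2 (suc n) ⟩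
  2 + 2 * suc n            ≤⟨ +-mono-≤ (*-monoʳ-≤ 2 (m^n>0 2 n)) (2*n≤2^n (suc n)) ⟩
  2 ^ suc n + 2 ^ suc n    ≡⟨ ≡.cong (2 ^ suc n +_) (+-identityʳ (2 ^ suc n)) ⟨
  2 ^ suc (suc n)          ∎
  where open Data.Nat.Properties.≤-Reasoning

proposition3 : (q : ℕ) → IsPrimePower q → (F : FiniteField q) →
    let open LinearAlgebra F in
    (n k : ℕ) → 1 < k → k < n ∸ 1 → n < 2 * k →
    (U : VSet n) → HasDim U (suc k) → NotInCoordHyperplane U →
    IsMaximalClique n k (SubsC n k U)
proposition3 q _ F n (suc m) 1<k _ n<2k U U-dim U-nc =
  SubsC-maximal-clique F U-dim U-nc (<-≤-trans n<2k (2*n≤2^n (suc m))) (s<s⁻¹ 1<k)
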